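{- Let $\mathcal{C}$ be a robust graph class for which $\beta_{\mathcal{C}}$ is finite. For every integer $d\ge1$, \[ \beta_{\mathcal{C}}(d)\ge\begin{cases}2^{d-1}+1 & \text{if } \beta_{\mathcal{C}}=1,\\ (\beta_{\mathcal{C}}-1)2^d+1 & \text{if } \beta_{\mathcal{C}}\ge 2.\end{cases} \]
   Context: All graphs are finite, simple and undirected. A set $Y\subseteq V(G)$ is a blocking set of $G$ if no minimum vertex cover of $G$ contains $Y$; minimal if no proper subset is a blocking set. $\beta(G)$ is the maximum size of a minimal blocking set of $G$; $\beta_{\mathcal{C}}=\max_{G\in\mathcal{C}}\beta(G)$ ($\infty$ if unbounded). A class is robust if closed under disjoint union and under removing connected components. Elimination distance: $\mathrm{ed}_{\mathcal{C}}(G)=0$ if $G\in\mathcal{C}$; $\min_v\mathrm{ed}_{\mathcal{C}}(G-v)+1$ if $G\notin\mathcal{C}$ is connected; the maximum over connected components otherwise. $\beta_{\mathcal{C}}(d)=\max\{\beta(G):\mathrm{ed}_{\mathcal{C}}(G)\le d\}$. -}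

module Defs where

open import Data.Nat using (ℕ; zero; suc; _+_; _≤_)
open import Data.Bool using (Bool; true; false)
open import Data.Fin using (Fin; splitAt)
open import Data.Fin.Subset using (Subset; _∈_; _⊆_; _⊂_; ∣_∣)
open import Data.Sum using (_⊎_; inj₁; inj₂)
open import Data.Product using (Σ; ∃; _×_; _,_)
open import Relation.Nullary using (¬_)
open import Relation.Binary.PropositionalEquality using (_≡_; refl)
open import Function.Bundles using (_↔_; Inverse)
open import Function.Definitions using (Injective)

record Graph : Set where
  field
    n       : ℕ
    adj     : Fin n → Fin n → Bool
    adj-sym : ∀ i j → adj i j ≡ adj j i
    adj-irr : ∀ i → adj i i ≡ false
open Graph public

Edge : (G : Graph) → Fin (n G) → Fin (n G) → Set
Edge G i j = adj G i j ≡ true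

record _≅_ (G H : Graph) : Set where
  field
    bij      : Fin (n G) ↔ Fin (n H)
    preserve : ∀ i j → adj H (Inverse.to bij i) (Inverse.to bij j) ≡ adj G i j

GraphClass : (Graph → Set) → Set
GraphClass C = ∀ G H → G ≅ H → C G → C H

adjSum : (G H : Graph) → Fin (n G) ⊎ Fin (n H) → Fin (n G) ⊎ Fin (n H) → Bool
adjSum G H (inj₁ a) (inj₁ b) = adj G a b
adjSum G H (inj₂ a) (inj₂ b) = adj H a b
adjSum G H (inj₁ a) (inj₂ b) = false
adjSum G H (inj₂ a) (inj₁ b) = false

adjSum-sym : ∀ G H x y → adjSum G H x y ≡ adjSum G H y x
adjSum-sym G H (inj₁ a) (inj₁ b) = adj-sym G a b
adjSum-sym G H (inj₂ a) (inj₂ b) = adj-sym H a b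
adjSum-sym G H (inj₁ a) (inj₂ b) = refl
adjSum-sym G H (inj₂ a) (inj₁ b) = refl

adjSum-irr : ∀ G H x → adjSum G H x x ≡ false
adjSum-irr G H (inj₁ a) = adj-irr G a
adjSum-irr G H (inj₂ a) = adj-irr H a

_⊕_ : Graph → Graph → Graph
G ⊕ H = record
  { n       = n G + n H
  ; adj     = λ i j → adjSum G H (splitAt (n G) i) (splitAt (n G) j)
  ; adj-sym = λ i j → adjSum-sym G H (splitAt (n G) i) (splitAt (n G) j)
  ; adj-irr = λ i → adjSum-irr G H (splitAt (n G) i)
  }

-- Induced subgraphs along a map f : Fin k → V(G)
-- (used with injective f; the image of f is the vertex set kept)

Induced : (G : Graph) {k : ℕ} → (Fin k → Fin (n G)) → Graph
Induced G {k} f = record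
  { n       = k
  ; adj     = λ i j → adj G (f i) (f j)
  ; adj-sym = λ i j → adj-sym G (f i) (f j)
  ; adj-irr = λ i → adj-irr G (f i)
  }

Enumerates : (G : Graph) {k : ℕ} → (Fin k → Fin (n G)) → (Fin (n G) → Set) → Set
Enumerates G f P =
  Injective _≡_ _≡_ f × (∀ v → (P v → ∃ λ i → f i ≡ v) × ((∃ λ i → f i ≡ v) → P v))

data Reach (G : Graph) (u : Fin (n G)) : Fin (n G) → Set where
  here : Reach G u u
  step : ∀ {v w} → Reach G u v → Edge G v w → Reach G u w

-- connected graphs are nonempty
Connected : Graph → Set
Connected G = Fin (n G) × (∀ u v → Reach G u v)

IsComponentOf : Graph → Graph → Set
IsComponentOf H G =
  Σ (Fin (n G)) λ u → Σ ℕ λ k → Σ (Fin k → Fin (n G)) λ f →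
    Enumerates G f (Reach G u) × (H ≡ Induced G f)

IsComponentDeletionOf : Graph → Graph → Set
IsComponentDeletionOf H G =
  Σ (Fin (n G)) λ u → Σ ℕ λ k → Σ (Fin k → Fin (n G)) λ f →
    Enumerates G f (λ v → ¬ Reach G u v) × (H ≡ Induced G f)

Robust : (Graph → Set) → Set
Robust C =
  (∀ G H → C G → C H → C (G ⊕ H)) ×
  (∀ G H → C G → IsComponentDeletionOf H G → C H)

IsVertexCover : (G : Graph) → Subset (n G) → Set
IsVertexCover G S = ∀ i j → Edge G i j → i ∈ S ⊎ j ∈ S

IsMinVertexCover : (G : Graph) → Subset (n G) → Set
IsMinVertexCover G S =
  IsVertexCover G S × (∀ T → IsVertexCover G T → ∣ S ∣ ≤ ∣ T ∣)

IsBlocking : (G : Graph) → Subset (n G) → Set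
IsBlocking G Y = ∀ S → IsMinVertexCover G S → ¬ (Y ⊆ S)

IsMinimalBlocking : (G : Graph) → Subset (n G) → Set
IsMinimalBlocking G Y = IsBlocking G Y × (∀ Z → Z ⊂ Y → ¬ IsBlocking G Z)

-- β(G) ≥ N   (β(G) = max size of a minimal blocking set, 0 if none)
BetaGe : Graph → ℕ → Set
BetaGe G N = N ≡ 0 ⊎ (∃ λ Y → IsMinimalBlocking G Y × N ≤ ∣ Y ∣)

BetaLe : Graph → ℕ → Set
BetaLe G N = ∀ Y → IsMinimalBlocking G Y → ∣ Y ∣ ≤ N

ClassBetaIs : (Graph → Set) → ℕ → Set
ClassBetaIs C b = (∀ G → C G → BetaLe G b) × (∃ λ G → C G × BetaGe G b)

-- Elimination distance: EdLe C G d  ⇔  ed_C(G) ≤ d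

data EdLe (C : Graph → Set) : Graph → ℕ → Set where
  inClass   : ∀ {G d} → C G → EdLe C G d
  delete    : ∀ {G d} → ¬ C G → Connected G →
              (v : Fin (n G)) → {k : ℕ} → (σ : Fin k → Fin (n G)) →
              Enumerates G σ (λ w → ¬ (w ≡ v)) →
              EdLe C (Induced G σ) d → EdLe C G (suc d)
  componentwise : ∀ {G d} → ¬ C G → ¬ Connected G →
              (∀ H → IsComponentOf H G → EdLe C H d) → EdLe C G d

BetaEdGe : (Graph → Set) → ℕ → ℕ → Set
BetaEdGe C d N = ∃ λ G → EdLe C G d × BetaGe G N

-- From a member of C attaining b we pass to the component carrying the minimal
-- blocking set: a connected member of C (robustness) with a minimal blocking set
-- of the same size (a minimal blocking set of a disjoint union lies in one side).
-- For connected G with minimal blocking set Y and y ∈ Y, two cones enlarge Y: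
--   apex extension     Cone G Y, blocking set {apex} ∪ Y of size |Y| + 1;
--   doubling extension Cone (G ⊕ G) (Y ∪ {y′}), blocking set Y ∪ (Y′ - y′) in the
--                      two copies, of size 2|Y| - 1.
-- Once the blocking set exceeds b the connected cone lies outside C, so deleting
-- its apex costs one unit of elimination distance, while G ⊕ G has the distance of
-- G (its components are copies of G).  The apex extension (b = 1) or the doubling
-- of a seed (b ≥ 2, G ⊕ G ∈ C) gives d = 1, and every further doubling, K ↦ 2K - 1,
-- gives d + 1.  The file develops subset cardinalities, reachability, isomorphisms,
-- covers and blocking sets, disjoint unions, cones, the two extensions, components,
-- elimination distance, and finally the iteration proving the theorem.

module Submission where

open import Defs
open import Data.Nat using (ℕ; zero; suc; _+_; _*_; _∸_; _^_; _≤_; _<_; _≤?_; z≤n; s≤s)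
open import Data.Nat.Properties
  using (≤-refl; ≤-reflexive; ≤-trans; +-mono-≤; +-monoʳ-≤; +-comm; +-suc; +-identityʳ;
         n≤1+n; 1+n≰n; ≤-antisym; ≰⇒>; suc-injective; ≤-pred; module ≤-Reasoning;
         +-cancelˡ-≤; +-cancelʳ-≤; <⇒≱; <⇒≢; m≤n+m; +-0-commutativeMonoid)
import Data.Bool as Bool
open import Data.Bool using (true; false)
open import Data.Bool.Properties using (¬-not)
open import Data.Fin using (Fin; zero; suc; _↑ˡ_; _↑ʳ_; splitAt; punchOut)
import Data.Fin.Properties as Fin
open import Data.Fin.Subset hiding (⊤)
open import Data.Fin.Subset.Properties
  using (_∈?_; _⊆?_; x∈⁅x⁆; x∈⁅y⁆⇒x≡y; ∣⁅x⁆∣≡1; ∣p∣≤n; p⊆q⇒∣p∣≤∣q∣; p⊂q⇒∣p∣<∣q∣; x∈p∪q⁺;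
         x∈p∧x≢y⇒x∈p-y; x∈p⇒p-x⊂p; p⊆p∪q; p─q⊆p; ∉⊥; drop-there; nonempty?; Empty-unique; ∣⊥∣≡0; anySubset?)
open import Data.Vec using ([]; _∷_; lookup; tabulate; _++_; here; there)
import Data.Vec as Vec
open import Data.Vec.Properties using ([]=⇒lookup; lookup⇒[]=; lookup∘tabulate; lookup-++ˡ; lookup-++ʳ)
open import Data.Sum using (_⊎_; inj₁; inj₂; [_,_])
import Data.Sum as Sum
open import Data.Product using (Σ; ∃; _×_; _,_; proj₁; proj₂)
open import Data.Empty using (⊥-elim)
open import Data.Unit using (⊤; tt)
open import Relation.Nullary using (¬_; Dec; does; yes; no; contradiction)
open import Relation.Nullary.Decidable
  using (dec-true; map′; ¬?; decidable-stable; _⊎-dec_; _×-dec_; _→-dec_)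
open import Function.Definitions using (Injective)
open import Relation.Binary.PropositionalEquality
  using (_≡_; refl; sym; trans; cong; cong₂; subst; subst₂; _≢_; module ≡-Reasoning)
open import Function using (_∘_; id; const)
open import Function.Bundles using (_↔_; Inverse; mk↔ₛ′)
import Algebra.Properties.CommutativeMonoid.Sum as Summation
open import Data.Nat.Tactic.RingSolver using (solve-∀)

open Summation +-0-commutativeMonoid using (sum; sum-cong-≗; sum-permute)

∣p∪q∣≤∣p∣+∣q∣ : ∀ {m} (p q : Subset m) → ∣ p ∪ q ∣ ≤ ∣ p ∣ + ∣ q ∣
∣p∪q∣≤∣p∣+∣q∣ [] [] = z≤n
∣p∪q∣≤∣p∣+∣q∣ (outside ∷ p) (outside ∷ q) = ∣p∪q∣≤∣p∣+∣q∣ p q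
∣p∪q∣≤∣p∣+∣q∣ (inside ∷ p) (outside ∷ q) = s≤s (∣p∪q∣≤∣p∣+∣q∣ p q)
∣p∪q∣≤∣p∣+∣q∣ (inside ∷ p) (inside ∷ q) =
  s≤s (≤-trans (∣p∪q∣≤∣p∣+∣q∣ p q) (+-monoʳ-≤ ∣ p ∣ (n≤1+n ∣ q ∣)))
∣p∪q∣≤∣p∣+∣q∣ (outside ∷ p) (inside ∷ q) =
  ≤-trans (s≤s (∣p∪q∣≤∣p∣+∣q∣ p q)) (≤-reflexive (sym (+-suc ∣ p ∣ ∣ q ∣)))

∣p∪⁅x⁆∣≤1+∣p∣ : ∀ {m} (p : Subset m) x → ∣ p ∪ ⁅ x ⁆ ∣ ≤ suc ∣ p ∣
∣p∪⁅x⁆∣≤1+∣p∣ p x = ≤-trans (∣p∪q∣≤∣p∣+∣q∣ p ⁅ x ⁆)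
  (≤-reflexive (trans (cong (∣ p ∣ +_) (∣⁅x⁆∣≡1 x)) (+-comm ∣ p ∣ 1)))

∣p∣≤1+∣p-x∣ : ∀ {m} (p : Subset m) x → ∣ p ∣ ≤ suc ∣ p - x ∣
∣p∣≤1+∣p-x∣ p x = ≤-trans (p⊆q⇒∣p∣≤∣q∣ p⊆p-x∪x) (∣p∪⁅x⁆∣≤1+∣p∣ (p - x) x)
  where
  p⊆p-x∪x : p ⊆ (p - x) ∪ ⁅ x ⁆
  p⊆p-x∪x {y} y∈p with y Fin.≟ x
  ... | yes refl = x∈p∪q⁺ (inj₂ (x∈⁅x⁆ x))
  ... | no y≢x = x∈p∪q⁺ (inj₁ (x∈p∧x≢y⇒x∈p-y y∈p y≢x))

x∈p-y⇒x≢y : ∀ {m} {p : Subset m} {x y} → x ∈ p - y → x ≢ y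
x∈p-y⇒x≢y {y = y} x∈ refl = x∉p─q x∈ (x∈⁅x⁆ y)
  where
  x∉p─q : ∀ {m} {p q : Subset m} {x} → x ∈ p ─ q → x ∉ q
  x∉p─q {p = _ ∷ _} {outside ∷ _} here ()
  x∉p─q {p = _ ∷ _} {_ ∷ _} (there x∈) (there x∈q) = x∉p─q x∈ x∈q

∣p++q∣ : ∀ {k m} (p : Subset k) (q : Subset m) → ∣ p ++ q ∣ ≡ ∣ p ∣ + ∣ q ∣
∣p++q∣ [] q = refl
∣p++q∣ (outside ∷ p) q = ∣p++q∣ p q
∣p++q∣ (inside ∷ p) q = cong suc (∣p++q∣ p q)

∣p++⊥∣ : ∀ {k} l (p : Subset k) → ∣ p ++ ⊥ {n = l} ∣ ≡ ∣ p ∣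
∣p++⊥∣ l p = trans (∣p++q∣ p ⊥) (trans (cong (∣ p ∣ +_) (∣⊥∣≡0 l)) (+-identityʳ ∣ p ∣))

∣p∣>0⇒nonempty : ∀ {m} (p : Subset m) → 0 < ∣ p ∣ → Nonempty p
∣p∣>0⇒nonempty {m} p 0<∣p∣ with nonempty? p
... | yes ne = ne
... | no empty = contradiction (trans (cong ∣_∣ (Empty-unique empty)) (∣⊥∣≡0 m)) (<⇒≢ 0<∣p∣ ∘ sym)

indicator : Side → ℕ
indicator inside = 1
indicator outside = 0

∣p∣≡Σ : ∀ {m} (p : Subset m) → ∣ p ∣ ≡ sum (indicator ∘ lookup p)
∣p∣≡Σ [] = refl
∣p∣≡Σ (outside ∷ p) = ∣p∣≡Σ p
∣p∣≡Σ (inside ∷ p) = cong suc (∣p∣≡Σ p)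

∣tabulate∘lookup∣ : ∀ {k m} (p : Subset m) (π : Fin k ↔ Fin m) →
                    ∣ tabulate (lookup p ∘ Inverse.to π) ∣ ≡ ∣ p ∣
∣tabulate∘lookup∣ {k} p π = begin
  ∣ tabulate f ∣                         ≡⟨ ∣p∣≡Σ (tabulate f) ⟩
  sum (indicator ∘ lookup (tabulate f))  ≡⟨ sum-cong-≗ (cong indicator ∘ lookup∘tabulate f) ⟩
  sum (indicator ∘ f)                    ≡⟨ sum-permute (indicator ∘ lookup p) π ⟨
  sum (indicator ∘ lookup p)             ≡⟨ ∣p∣≡Σ p ⟨
  ∣ p ∣                                  ∎
  where
  open ≡-Reasoning
  f : Fin k → Side
  f = lookup p ∘ Inverse.to π

∈tabulate⁺ : ∀ {m} {f : Fin m → Side} {i} → f i ≡ inside → i ∈ tabulate f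
∈tabulate⁺ {f = f} {i} fi = lookup⇒[]= i (tabulate f) (trans (lookup∘tabulate f i) fi)

∈tabulate⁻ : ∀ {m} {f : Fin m → Side} {i} → i ∈ tabulate f → f i ≡ inside
∈tabulate⁻ {f = f} {i} i∈ = trans (sym (lookup∘tabulate f i)) ([]=⇒lookup i∈)

subsetOf : ∀ {m} {P : Fin m → Set} → (∀ i → Dec (P i)) → Subset m
subsetOf P? = tabulate (does ∘ P?)

∈subsetOf⁺ : ∀ {m} {P : Fin m → Set} (P? : ∀ i → Dec (P i)) {i} → P i → i ∈ subsetOf P?
∈subsetOf⁺ P? {i} Pi = ∈tabulate⁺ (dec-true (P? i) Pi)

∈subsetOf⁻ : ∀ {m} {P : Fin m → Set} (P? : ∀ i → Dec (P i)) {i} → i ∈ subsetOf P? → P i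
∈subsetOf⁻ P? {i} i∈ with P? i | ∈tabulate⁻ {f = does ∘ P?} i∈
... | yes Pi | _ = Pi
... | no _ | ()

data Half (m k : ℕ) : Fin (m + k) → Set where
  left  : (a : Fin m) → Half m k (a ↑ˡ k)
  right : (c : Fin k) → Half m k (m ↑ʳ c)

half : ∀ m {k} (x : Fin (m + k)) → Half m k x
half zero c = right c
half (suc m) zero = left zero
half (suc m) (suc x) with half m x
... | left a = left (suc a)
... | right c = right c

module _ {k m} {p : Subset k} {q : Subset m} where
  ↑ˡ∈++⁺ : ∀ {a} → a ∈ p → a ↑ˡ m ∈ p ++ q
  ↑ˡ∈++⁺ {a} a∈ = lookup⇒[]= _ (p ++ q) (trans (lookup-++ˡ p q a) ([]=⇒lookup a∈))

  ↑ˡ∈++⁻ : ∀ {a} → a ↑ˡ m ∈ p ++ q → a ∈ p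
  ↑ˡ∈++⁻ {a} a∈ = lookup⇒[]= a p (trans (sym (lookup-++ˡ p q a)) ([]=⇒lookup a∈))

  ↑ʳ∈++⁺ : ∀ {c} → c ∈ q → k ↑ʳ c ∈ p ++ q
  ↑ʳ∈++⁺ {c} c∈ = lookup⇒[]= _ (p ++ q) (trans (lookup-++ʳ p q c) ([]=⇒lookup c∈))

  ↑ʳ∈++⁻ : ∀ {c} → k ↑ʳ c ∈ p ++ q → c ∈ q
  ↑ʳ∈++⁻ {c} c∈ = lookup⇒[]= c q (trans (sym (lookup-++ʳ p q c)) ([]=⇒lookup c∈))

Vertex : Graph → Set
Vertex G = Fin (n G)

edge-sym : ∀ G {a b : Vertex G} → Edge G a b → Edge G b a
edge-sym G {a} {b} e = trans (adj-sym G b a) e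

reach-trans : ∀ {G} {u v w : Vertex G} → Reach G u v → Reach G v w → Reach G u w
reach-trans p here = p
reach-trans p (step q e) = step (reach-trans p q) e

reach-sym : ∀ {G} {u v : Vertex G} → Reach G u v → Reach G v u
reach-sym here = here
reach-sym {G} (step p e) = reach-trans (step here (edge-sym G e)) (reach-sym p)

reach-map : ∀ {G H} (φ : Vertex G → Vertex H) → (∀ a b → Edge G a b → Edge H (φ a) (φ b)) →
            ∀ {u v} → Reach G u v → Reach H (φ u) (φ v)
reach-map φ hom here = here
reach-map φ hom (step p e) = step (reach-map φ hom p) (hom _ _ e)

-- Reachability is decidable: the balls of radius k around u grow until they
-- stabilise, which happens after at most n steps because each growing step adds
-- a vertex; a stable ball contains every vertex reachable from u.
module Balls (G : Graph) (u : Vertex G) where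
  Extends : Subset (n G) → Vertex G → Set
  Extends S w = w ∈ S ⊎ ∃ λ v → v ∈ S × Edge G v w

  extends? : ∀ S w → Dec (Extends S w)
  extends? S w = w ∈? S ⊎-dec Fin.any? (λ v → v ∈? S ×-dec (adj G v w Bool.≟ true))

  Ball : ℕ → Subset (n G)
  Ball zero = ⁅ u ⁆
  Ball (suc k) = subsetOf (extends? (Ball k))

  ball-sound : ∀ k {w} → w ∈ Ball k → Reach G u w
  ball-sound zero {w} w∈ with x∈⁅y⁆⇒x≡y u w∈
  ... | refl = here
  ball-sound (suc k) w∈ with ∈subsetOf⁻ (extends? (Ball k)) w∈
  ... | inj₁ w∈k = ball-sound k w∈k
  ... | inj₂ (v , v∈k , e) = step (ball-sound k v∈k) e

  ball-mono : ∀ k {w} → w ∈ Ball k → w ∈ Ball (suc k)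
  ball-mono k w∈ = ∈subsetOf⁺ (extends? (Ball k)) (inj₁ w∈)

  ball-step : ∀ k {v w} → v ∈ Ball k → Edge G v w → w ∈ Ball (suc k)
  ball-step k v∈ e = ∈subsetOf⁺ (extends? (Ball k)) (inj₂ (_ , v∈ , e))

  ball-centre : ∀ k → u ∈ Ball k
  ball-centre zero = x∈⁅x⁆ u
  ball-centre (suc k) = ball-mono k (ball-centre k)

  Stable : ℕ → Set
  Stable k = Ball (suc k) ⊆ Ball k

  unstable⇒⊂ : ∀ k → ¬ Stable k → Ball k ⊂ Ball (suc k)
  unstable⇒⊂ k ¬stable = ball-mono k , new
    where
    Kept : Vertex G → Set
    Kept w = w ∈ Ball (suc k) → w ∈ Ball k
    new : ∃ λ w → w ∈ Ball (suc k) × w ∉ Ball k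
    new with Fin.¬∀⟶∃¬ (n G) Kept (λ w → w ∈? Ball (suc k) →-dec w ∈? Ball k) (λ kept → ¬stable (kept _))
    ... | w , ¬kept with w ∈? Ball (suc k)
    ...   | yes w∈ = w , w∈ , λ w∈k → ¬kept (λ _ → w∈k)
    ...   | no w∉ = contradiction (λ w∈ → contradiction w∈ w∉) ¬kept

  growth : ∀ k → (∃ Stable) ⊎ (k ≤ ∣ Ball k ∣)
  growth zero = inj₂ z≤n
  growth (suc k) with growth k
  ... | inj₁ s = inj₁ s
  ... | inj₂ k≤ with Ball (suc k) ⊆? Ball k
  ...   | yes stable = inj₁ (k , stable)
  ...   | no ¬stable = inj₂ (≤-trans (s≤s k≤) (p⊂q⇒∣p∣<∣q∣ (unstable⇒⊂ k ¬stable)))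

  stable : ∃ Stable
  stable with growth (suc (n G))
  ... | inj₁ s = s
  ... | inj₂ big = contradiction (≤-trans big (∣p∣≤n (Ball (suc (n G))))) 1+n≰n

  radius : ℕ
  radius = proj₁ stable

  ball-complete : ∀ {w} → Reach G u w → w ∈ Ball radius
  ball-complete here = ball-centre radius
  ball-complete (step r e) = proj₂ stable (ball-step radius (ball-complete r) e)

reach? : ∀ G (u w : Vertex G) → Dec (Reach G u w)
reach? G u w = map′ (ball-sound radius) ball-complete (w ∈? Ball radius)
  where open Balls G u

-- Defs.Enumerates G f P depends on G only through n G; this is its version for
-- an arbitrary Fin m, which is definitionally the same type when m = n G
EnumeratesFin : (m : ℕ) {k : ℕ} → (Fin k → Fin m) → (Fin m → Set) → Set
EnumeratesFin m f P = Injective _≡_ _≡_ f × (∀ v → (P v → ∃ λ i → f i ≡ v) × ((∃ λ i → f i ≡ v) → P v))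

module _ {m k} {f : Fin k → Fin m} {P : Fin m → Set} (en : EnumeratesFin m f P) where
  index : ∀ {v} → P v → ∃ λ i → f i ≡ v
  index {v} Pv = proj₁ (proj₂ en v) Pv

  enumerated : ∀ i → P (f i)
  enumerated i = proj₂ (proj₂ en (f i)) (i , refl)

enumerate : ∀ {m} (P : Fin m → Set) → (∀ v → Dec (P v)) →
            Σ ℕ λ k → Σ (Fin k → Fin m) λ f → EnumeratesFin m f P
enumerate {zero} P P? = 0 , (λ ()) , (λ {}) , (λ ())
enumerate {suc m} P P? with enumerate (P ∘ suc) (P? ∘ suc) | P? zero
... | k , f , f-inj , f-enum | yes P0 = suc k , g , g-inj , g-enum
  where
  g : Fin (suc k) → Fin (suc m)
  g zero = zero
  g (suc i) = suc (f i)
  g-inj : Injective _≡_ _≡_ g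
  g-inj {zero} {zero} _ = refl
  g-inj {suc i} {suc j} e = cong suc (f-inj (Fin.suc-injective e))
  g-enum : ∀ v → (P v → ∃ λ i → g i ≡ v) × ((∃ λ i → g i ≡ v) → P v)
  g-enum zero = (λ _ → zero , refl) , (λ _ → P0)
  g-enum (suc v) = (λ Pv → let i , e = proj₁ (f-enum v) Pv in suc i , cong suc e)
                 , λ { (suc i , e) → proj₂ (f-enum v) (i , Fin.suc-injective e) }
... | k , f , f-inj , f-enum | no ¬P0 = k , suc ∘ f , f-inj ∘ Fin.suc-injective , g-enum
  where
  g-enum : ∀ v → (P v → ∃ λ i → suc (f i) ≡ v) × ((∃ λ i → suc (f i) ≡ v) → P v)
  g-enum zero = (λ P0 → contradiction P0 ¬P0) , λ { (_ , ()) }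
  g-enum (suc v) = (λ Pv → let i , e = proj₁ (f-enum v) Pv in i , cong suc e)
                 , λ { (i , e) → proj₂ (f-enum v) (i , Fin.suc-injective e) }

module _ {G H : Graph} (I : G ≅ H) where
  to : Vertex G → Vertex H
  to = Inverse.to (_≅_.bij I)

  from : Vertex H → Vertex G
  from = Inverse.from (_≅_.bij I)

  to-from : ∀ y → to (from y) ≡ y
  to-from = Inverse.strictlyInverseˡ (_≅_.bij I)

  from-to : ∀ x → from (to x) ≡ x
  from-to = Inverse.strictlyInverseʳ (_≅_.bij I)

  to-injective : ∀ {x y} → to x ≡ to y → x ≡ y
  to-injective {x} {y} e = trans (sym (from-to x)) (trans (cong from e) (from-to y))

mkIso : ∀ {G H} (f : Vertex G → Vertex H) (g : Vertex H → Vertex G) →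
        (∀ y → f (g y) ≡ y) → (∀ x → g (f x) ≡ x) →
        (∀ i j → adj H (f i) (f j) ≡ adj G i j) → G ≅ H
mkIso f g fg gf pres = record { bij = mk↔ₛ′ f g fg gf ; preserve = pres }

relabel : ∀ {G H} {k} (f : Fin k → Vertex G) (g : Fin k → Vertex H) →
          (∀ i j → adj H (g i) (g j) ≡ adj G (f i) (f j)) → Induced G f ≅ Induced H g
relabel f g pres = mkIso id id (λ _ → refl) (λ _ → refl) pres

≅-sym : ∀ {G H} → G ≅ H → H ≅ G
≅-sym {G} {H} I = mkIso (from I) (to I) (from-to I) (to-from I) pres
  where
  pres : ∀ i j → adj G (from I i) (from I j) ≡ adj H i j
  pres i j = trans (sym (_≅_.preserve I (from I i) (from I j))) (cong₂ (adj H) (to-from I i) (to-from I j))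

≅-trans : ∀ {G H K} → G ≅ H → H ≅ K → G ≅ K
≅-trans I J = mkIso (to J ∘ to I) (from I ∘ from J)
  (λ y → trans (cong (to J) (to-from I (from J y))) (to-from J y))
  (λ x → trans (cong (from I) (from-to J (to I x))) (from-to I x))
  (λ i j → trans (_≅_.preserve J (to I i) (to I j)) (_≅_.preserve I i j))

≅-reach : ∀ {G H} (I : G ≅ H) {a b} → Reach G a b → Reach H (to I a) (to I b)
≅-reach I = reach-map (to I) (λ a b e → trans (_≅_.preserve I a b) e)

≅-connected : ∀ {G H} → G ≅ H → Connected G → Connected H
≅-connected {H = H} I (x , conn) = to I x , λ u w →
  subst₂ (Reach H) (to-from I u) (to-from I w) (≅-reach I (conn (from I u) (from I w)))

≅-enumerations : ∀ G {k l} {f : Fin k → Vertex G} {g : Fin l → Vertex G} {P Q : Vertex G → Set} →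
                 Enumerates G f P → Enumerates G g Q → (∀ v → P v → Q v) → (∀ v → Q v → P v) →
                 Induced G f ≅ Induced G g
≅-enumerations G {k} {l} {f} {g} ef eg P⇒Q Q⇒P = mkIso f→g g→f f→g→f g→f→g pres
  where
  f→g : Fin k → Fin l
  f→g i = proj₁ (index eg (P⇒Q _ (enumerated ef i)))
  g∘f→g : ∀ i → g (f→g i) ≡ f i
  g∘f→g i = proj₂ (index eg (P⇒Q _ (enumerated ef i)))
  g→f : Fin l → Fin k
  g→f j = proj₁ (index ef (Q⇒P _ (enumerated eg j)))
  f∘g→f : ∀ j → f (g→f j) ≡ g j
  f∘g→f j = proj₂ (index ef (Q⇒P _ (enumerated eg j)))
  f→g→f : ∀ j → f→g (g→f j) ≡ j
  f→g→f j = proj₁ eg (trans (g∘f→g (g→f j)) (f∘g→f j))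
  g→f→g : ∀ i → g→f (f→g i) ≡ i
  g→f→g i = proj₁ ef (trans (f∘g→f (f→g i)) (g∘f→g i))
  pres : ∀ i j → adj G (g (f→g i)) (g (f→g j)) ≡ adj G (f i) (f j)
  pres i j = cong₂ (adj G) (g∘f→g i) (g∘f→g j)

≅-split : ∀ G {k l} {f : Fin k → Vertex G} {g : Fin l → Vertex G} {P : Vertex G → Set} →
          (∀ v → Dec (P v)) → (∀ a b → P a → Edge G a b → P b) →
          Enumerates G f P → Enumerates G g (λ v → ¬ P v) →
          (Induced G f ⊕ Induced G g) ≅ G
≅-split G {k} {l} {f} {g} {P} P? closed ef eg = mkIso join split join-split split-join pres
  where
  join : Fin (k + l) → Vertex G
  join x = [ f , g ] (splitAt k x)
  split : Vertex G → Fin (k + l)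
  split v with P? v
  ... | yes Pv = proj₁ (index ef Pv) ↑ˡ l
  ... | no ¬Pv = k ↑ʳ proj₁ (index eg ¬Pv)
  join-split : ∀ v → join (split v) ≡ v
  join-split v with P? v
  ... | yes Pv rewrite Fin.splitAt-↑ˡ k (proj₁ (index ef Pv)) l = proj₂ (index ef Pv)
  ... | no ¬Pv rewrite Fin.splitAt-↑ʳ k l (proj₁ (index eg ¬Pv)) = proj₂ (index eg ¬Pv)
  split-join : ∀ x → split (join x) ≡ x
  split-join x with half k x
  ... | left a rewrite Fin.splitAt-↑ˡ k a l with P? (f a)
  ...   | yes Pv = cong (_↑ˡ l) (proj₁ ef (proj₂ (index ef Pv)))
  ...   | no ¬Pv = contradiction (enumerated ef a) ¬Pv
  split-join x | right c rewrite Fin.splitAt-↑ʳ k l c with P? (g c)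
  ...   | yes Pv = contradiction Pv (enumerated eg c)
  ...   | no ¬Pv = cong (k ↑ʳ_) (proj₁ eg (proj₂ (index eg ¬Pv)))
  no-edge : ∀ {a b} → P a → ¬ P b → adj G a b ≡ false
  no-edge Pa ¬Pb = ¬-not (λ e → ¬Pb (closed _ _ Pa e))
  pres : ∀ i j → adj G (join i) (join j) ≡ adj (Induced G f ⊕ Induced G g) i j
  pres i j with splitAt k i | splitAt k j
  ... | inj₁ a | inj₁ b = refl
  ... | inj₂ a | inj₂ b = refl
  ... | inj₁ a | inj₂ b = no-edge (enumerated ef a) (enumerated eg b)
  ... | inj₂ a | inj₁ b = trans (adj-sym G (g a) (f b)) (no-edge (enumerated ef b) (enumerated eg a))

cover? : ∀ G S → Dec (IsVertexCover G S)
cover? G S = Fin.all? λ i → Fin.all? λ j → (adj G i j Bool.≟ true) →-dec (i ∈? S ⊎-dec j ∈? S)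

min-cover? : ∀ G S → Dec (IsMinVertexCover G S)
min-cover? G S = cover? G S ×-dec minimum?
  where
  minimum? : Dec (∀ T → IsVertexCover G T → ∣ S ∣ ≤ ∣ T ∣)
  minimum? with anySubset? {P = λ T → IsVertexCover G T × ¬ ∣ S ∣ ≤ ∣ T ∣}
                           (λ T → cover? G T ×-dec ¬? (∣ S ∣ ≤? ∣ T ∣))
  ... | yes (T , cover , smaller) = no (λ min → smaller (min T cover))
  ... | no none = yes λ T cover → decidable-stable (∣ S ∣ ≤? ∣ T ∣) (λ ≰ → none (T , cover , ≰))

extend : ∀ G Z → ¬ IsBlocking G Z → ∃ λ S → IsMinVertexCover G S × Z ⊆ S
extend G Z ¬blocking with anySubset? {P = λ S → IsMinVertexCover G S × Z ⊆ S}
                                     (λ S → min-cover? G S ×-dec Z ⊆? S)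
... | yes found = found
... | no none = ⊥-elim (¬blocking λ S min Z⊆S → none (S , min , Z⊆S))

blocking? : ∀ G Z → Dec (IsBlocking G Z)
blocking? G Z with anySubset? {P = λ S → IsMinVertexCover G S × Z ⊆ S}
                              (λ S → min-cover? G S ×-dec Z ⊆? S)
... | yes (S , min , Z⊆S) = no (λ blocking → blocking S min Z⊆S)
... | no none = yes (λ S min Z⊆S → none (S , min , Z⊆S))

cover-⊆ : ∀ G {S T} → IsVertexCover G S → S ⊆ T → IsVertexCover G T
cover-⊆ G cover S⊆T i j e = Sum.map S⊆T S⊆T (cover i j e)

min-cover-≤ : ∀ G {S T} → IsMinVertexCover G S → IsVertexCover G T → ∣ T ∣ ≤ ∣ S ∣ →
              IsMinVertexCover G T
min-cover-≤ G (_ , min) cover ∣T∣≤∣S∣ = cover , λ T′ cover′ → ≤-trans ∣T∣≤∣S∣ (min T′ cover′)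

min-cover-size : ∀ G {S T} → IsMinVertexCover G S → IsMinVertexCover G T → ∣ S ∣ ≡ ∣ T ∣
min-cover-size G (coverS , minS) (coverT , minT) = ≤-antisym (minS _ coverT) (minT _ coverS)

blocking⇒larger : ∀ G {Y S T} → IsBlocking G Y → IsMinVertexCover G S →
                  IsVertexCover G T → Y ⊆ T → suc ∣ S ∣ ≤ ∣ T ∣
blocking⇒larger G {S = S} {T} blocking min cover Y⊆T with ∣ T ∣ ≤? ∣ S ∣
... | yes ∣T∣≤∣S∣ = ⊥-elim (blocking T (min-cover-≤ G min cover ∣T∣≤∣S∣) Y⊆T)
... | no ∣T∣≰∣S∣ = ≰⇒> ∣T∣≰∣S∣

-- For a minimal blocking set Y and z ∈ Y, the set Y - z is not blocking, so some
-- minimum cover `minus-cover z` contains Y - z.  Adding z to it yields a cover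
-- `plus-cover z` containing Y, at most one larger than minimum.
module CriticalCovers (G : Graph) {Y : Subset (n G)} (minimal : IsMinimalBlocking G Y) where
  private
    witness : ∀ {z} → z ∈ Y → ∃ λ S → IsMinVertexCover G S × Y - z ⊆ S
    witness z∈Y = extend G _ (proj₂ minimal _ (x∈p⇒p-x⊂p z∈Y))

  minus-cover : ∀ {z} → z ∈ Y → Subset (n G)
  minus-cover z∈Y = proj₁ (witness z∈Y)

  minus-cover-min : ∀ {z} (z∈Y : z ∈ Y) → IsMinVertexCover G (minus-cover z∈Y)
  minus-cover-min z∈Y = proj₁ (proj₂ (witness z∈Y))

  minus-cover-⊇ : ∀ {z} (z∈Y : z ∈ Y) {x} → x ∈ Y → x ≢ z → x ∈ minus-cover z∈Y
  minus-cover-⊇ z∈Y x∈Y x≢z = proj₂ (proj₂ (witness z∈Y)) (x∈p∧x≢y⇒x∈p-y x∈Y x≢z)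

  plus-cover : ∀ {z} → z ∈ Y → Subset (n G)
  plus-cover {z} z∈Y = minus-cover z∈Y ∪ ⁅ z ⁆

  plus-cover-is-cover : ∀ {z} (z∈Y : z ∈ Y) → IsVertexCover G (plus-cover z∈Y)
  plus-cover-is-cover {z} z∈Y = cover-⊆ G (proj₁ (minus-cover-min z∈Y)) (p⊆p∪q {p = minus-cover z∈Y} ⁅ z ⁆)

  plus-cover-⊇ : ∀ {z} (z∈Y : z ∈ Y) → Y ⊆ plus-cover z∈Y
  plus-cover-⊇ {z} z∈Y {x} x∈Y with x Fin.≟ z
  ... | yes refl = x∈p∪q⁺ (inj₂ (x∈⁅x⁆ z))
  ... | no x≢z = x∈p∪q⁺ (inj₁ (minus-cover-⊇ z∈Y x∈Y x≢z))

  plus-cover-size : ∀ {z} (z∈Y : z ∈ Y) → ∣ plus-cover z∈Y ∣ ≤ suc ∣ minus-cover z∈Y ∣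
  plus-cover-size {z} z∈Y = ∣p∪⁅x⁆∣≤1+∣p∣ (minus-cover z∈Y) z

  minus-cover-size : ∀ {y z} (y∈Y : y ∈ Y) (z∈Y : z ∈ Y) → ∣ minus-cover y∈Y ∣ ≡ ∣ minus-cover z∈Y ∣
  minus-cover-size y∈Y z∈Y = min-cover-size G (minus-cover-min y∈Y) (minus-cover-min z∈Y)

  ⊇Y⇒larger : ∀ {z} (z∈Y : z ∈ Y) T → IsVertexCover G T → Y ⊆ T → suc ∣ minus-cover z∈Y ∣ ≤ ∣ T ∣
  ⊇Y⇒larger z∈Y T cover Y⊆T = blocking⇒larger G (proj₁ minimal) (minus-cover-min z∈Y) cover Y⊆T

pull : ∀ {G H} → G ≅ H → Subset (n H) → Subset (n G)
pull I S = tabulate (lookup S ∘ to I)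

∣pull∣ : ∀ {G H} (I : G ≅ H) S → ∣ pull I S ∣ ≡ ∣ S ∣
∣pull∣ I S = ∣tabulate∘lookup∣ S (_≅_.bij I)

∈pull⁺ : ∀ {G H} (I : G ≅ H) {S x} → to I x ∈ S → x ∈ pull I S
∈pull⁺ I x∈ = ∈tabulate⁺ ([]=⇒lookup x∈)

∈pull⁻ : ∀ {G H} (I : G ≅ H) {S x} → x ∈ pull I S → to I x ∈ S
∈pull⁻ I {S} x∈ = lookup⇒[]= _ S (∈tabulate⁻ x∈)

pull-⊆ : ∀ {G H} (I : G ≅ H) {S T} → S ⊆ T → pull I S ⊆ pull I T
pull-⊆ I S⊆T x∈ = ∈pull⁺ I (S⊆T (∈pull⁻ I x∈))

∈pull-pull⁺ : ∀ {G H} (I : G ≅ H) {S y} → y ∈ S → y ∈ pull (≅-sym I) (pull I S)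
∈pull-pull⁺ I {S} y∈ = ∈pull⁺ (≅-sym I) (∈pull⁺ I (subst (_∈ S) (sym (to-from I _)) y∈))

∈pull-pull⁻ : ∀ {G H} (I : G ≅ H) {S y} → y ∈ pull (≅-sym I) (pull I S) → y ∈ S
∈pull-pull⁻ I {S} y∈ = subst (_∈ S) (to-from I _) (∈pull⁻ I (∈pull⁻ (≅-sym I) y∈))

pull-cover : ∀ {G H} (I : G ≅ H) {S} → IsVertexCover H S → IsVertexCover G (pull I S)
pull-cover I cover i j e = Sum.map (∈pull⁺ I) (∈pull⁺ I) (cover _ _ (trans (_≅_.preserve I i j) e))

pull-min-cover : ∀ {G H} (I : G ≅ H) {S} → IsMinVertexCover H S → IsMinVertexCover G (pull I S)
pull-min-cover I {S} (cover , min) = pull-cover I cover , λ T coverT →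
  subst₂ _≤_ (sym (∣pull∣ I S)) (∣pull∣ (≅-sym I) T) (min _ (pull-cover (≅-sym I) coverT))

pull-blocking : ∀ {G H} (I : G ≅ H) {Y} → IsBlocking H Y → IsBlocking G (pull I Y)
pull-blocking I blocking S min Y⊆S =
  blocking _ (pull-min-cover (≅-sym I) min) λ y∈Y → pull-⊆ (≅-sym I) Y⊆S (∈pull-pull⁺ I y∈Y)

pull-⊂ : ∀ {G H} (I : G ≅ H) {Y Z} → Z ⊂ pull I Y → pull (≅-sym I) Z ⊂ Y
pull-⊂ I {Y} {Z} (Z⊆ , x , x∈ , x∉Z) =
  (λ y∈ → ∈pull-pull⁻ I (pull-⊆ (≅-sym I) Z⊆ y∈)) , to I x , ∈pull⁻ I x∈ ,
  λ x∈′ → x∉Z (subst (_∈ Z) (from-to I x) (∈pull⁻ (≅-sym I) x∈′))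

pull-minimal-blocking : ∀ {G H} (I : G ≅ H) {Y} → IsMinimalBlocking H Y → IsMinimalBlocking G (pull I Y)
pull-minimal-blocking I (blocking , minimal) =
  pull-blocking I blocking ,
  λ Z Z⊂ Z-blocking → minimal _ (pull-⊂ I Z⊂) (pull-blocking (≅-sym I) Z-blocking)

-- Disjoint unions: covers and blocking sets split between the two sides.
-- Every subset of V(A ⊕ B) has the form S₁ ++ S₂ (Data.Vec.splitAt).

module DisjointUnion (A B : Graph) where
  edgeˡ : ∀ a a′ → adj (A ⊕ B) (a ↑ˡ n B) (a′ ↑ˡ n B) ≡ adj A a a′
  edgeˡ a a′ rewrite Fin.splitAt-↑ˡ (n A) a (n B) | Fin.splitAt-↑ˡ (n A) a′ (n B) = refl

  edgeʳ : ∀ c c′ → adj (A ⊕ B) (n A ↑ʳ c) (n A ↑ʳ c′) ≡ adj B c c′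
  edgeʳ c c′ rewrite Fin.splitAt-↑ʳ (n A) (n B) c | Fin.splitAt-↑ʳ (n A) (n B) c′ = refl

  no-edge : ∀ a c → ¬ Edge (A ⊕ B) (a ↑ˡ n B) (n A ↑ʳ c)
  no-edge a c e rewrite Fin.splitAt-↑ˡ (n A) a (n B) | Fin.splitAt-↑ʳ (n A) (n B) c with e
  ... | ()

  cover-++ : ∀ {S₁ S₂} → IsVertexCover A S₁ → IsVertexCover B S₂ → IsVertexCover (A ⊕ B) (S₁ ++ S₂)
  cover-++ cover₁ cover₂ i j e with half (n A) i | half (n A) j
  ... | left a | left a′ = Sum.map ↑ˡ∈++⁺ ↑ˡ∈++⁺ (cover₁ a a′ (trans (sym (edgeˡ a a′)) e))
  ... | right c | right c′ = Sum.map ↑ʳ∈++⁺ ↑ʳ∈++⁺ (cover₂ c c′ (trans (sym (edgeʳ c c′)) e))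
  ... | left a | right c = ⊥-elim (no-edge a c e)
  ... | right c | left a = ⊥-elim (no-edge a c (edge-sym (A ⊕ B) e))

  cover-++⁻ˡ : ∀ {S₁ S₂} → IsVertexCover (A ⊕ B) (S₁ ++ S₂) → IsVertexCover A S₁
  cover-++⁻ˡ cover a a′ e = Sum.map ↑ˡ∈++⁻ ↑ˡ∈++⁻ (cover _ _ (trans (edgeˡ a a′) e))

  cover-++⁻ʳ : ∀ {S₁ S₂} → IsVertexCover (A ⊕ B) (S₁ ++ S₂) → IsVertexCover B S₂
  cover-++⁻ʳ cover c c′ e = Sum.map ↑ʳ∈++⁻ ↑ʳ∈++⁻ (cover _ _ (trans (edgeʳ c c′) e))

  cover-size : ∀ {S₁ S₂ T} → IsMinVertexCover A S₁ → IsMinVertexCover B S₂ →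
               IsVertexCover (A ⊕ B) T → ∣ S₁ ∣ + ∣ S₂ ∣ ≤ ∣ T ∣
  cover-size {T = T} (_ , min₁) (_ , min₂) cover with Vec.splitAt (n A) T
  ... | T₁ , T₂ , refl = subst (_ ≤_) (sym (∣p++q∣ T₁ T₂))
                           (+-mono-≤ (min₁ T₁ (cover-++⁻ˡ {T₁} cover)) (min₂ T₂ (cover-++⁻ʳ {T₁} cover)))

  min-cover-++ : ∀ {S₁ S₂} → IsMinVertexCover A S₁ → IsMinVertexCover B S₂ →
                 IsMinVertexCover (A ⊕ B) (S₁ ++ S₂)
  min-cover-++ {S₁} {S₂} min₁ min₂ = cover-++ (proj₁ min₁) (proj₁ min₂) , λ T cover →
    subst (_≤ ∣ T ∣) (sym (∣p++q∣ S₁ S₂)) (cover-size min₁ min₂ cover)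

  min-cover-++⁻ : ∀ {S₁ S₂} → IsMinVertexCover (A ⊕ B) (S₁ ++ S₂) →
                  IsMinVertexCover A S₁ × IsMinVertexCover B S₂
  min-cover-++⁻ {S₁} {S₂} (cover , min) = (cover₁ , min₁) , (cover₂ , min₂)
    where
    cover₁ : IsVertexCover A S₁
    cover₁ = cover-++⁻ˡ {S₁} cover
    cover₂ : IsVertexCover B S₂
    cover₂ = cover-++⁻ʳ {S₁} cover
    compare : ∀ {T₁ T₂} → IsVertexCover (A ⊕ B) (T₁ ++ T₂) → ∣ S₁ ∣ + ∣ S₂ ∣ ≤ ∣ T₁ ∣ + ∣ T₂ ∣
    compare {T₁} {T₂} coverT = subst₂ _≤_ (∣p++q∣ S₁ S₂) (∣p++q∣ T₁ T₂) (min (T₁ ++ T₂) coverT)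
    min₁ : ∀ T → IsVertexCover A T → ∣ S₁ ∣ ≤ ∣ T ∣
    min₁ T coverT = +-cancelʳ-≤ ∣ S₂ ∣ _ _ (compare {T} (cover-++ coverT cover₂))
    min₂ : ∀ T → IsVertexCover B T → ∣ S₂ ∣ ≤ ∣ T ∣
    min₂ T coverT = +-cancelˡ-≤ ∣ S₁ ∣ _ _ (compare {S₁} (cover-++ cover₁ coverT))

  ++-⊆ : ∀ {S₁ T₁ : Subset (n A)} {S₂ T₂ : Subset (n B)} → S₁ ⊆ T₁ → S₂ ⊆ T₂ → S₁ ++ S₂ ⊆ T₁ ++ T₂
  ++-⊆ S₁⊆T₁ S₂⊆T₂ {x} x∈ with half (n A) x
  ... | left a = ↑ˡ∈++⁺ (S₁⊆T₁ (↑ˡ∈++⁻ x∈))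
  ... | right c = ↑ʳ∈++⁺ (S₂⊆T₂ (↑ʳ∈++⁻ x∈))

  blocking-++ˡ : ∀ {Y₁} → IsBlocking A Y₁ → IsBlocking (A ⊕ B) (Y₁ ++ ⊥)
  blocking-++ˡ blocking S min Y⊆S with Vec.splitAt (n A) S
  ... | S₁ , S₂ , refl =
    blocking S₁ (proj₁ (min-cover-++⁻ {S₁} min)) (λ a∈ → ↑ˡ∈++⁻ {q = S₂} (Y⊆S (↑ˡ∈++⁺ a∈)))

  blocking-++ʳ : ∀ {Y₂} → IsBlocking B Y₂ → IsBlocking (A ⊕ B) (⊥ ++ Y₂)
  blocking-++ʳ blocking S min Y⊆S with Vec.splitAt (n A) S
  ... | S₁ , S₂ , refl =
    blocking S₂ (proj₂ (min-cover-++⁻ {S₁} min)) (λ c∈ → ↑ʳ∈++⁻ {p = S₁} (Y⊆S (↑ʳ∈++⁺ c∈)))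

  blocking-++⁻ : ∀ {Y₁ Y₂} → IsBlocking (A ⊕ B) (Y₁ ++ Y₂) → IsBlocking A Y₁ ⊎ IsBlocking B Y₂
  blocking-++⁻ {Y₁} {Y₂} blocking with blocking? A Y₁ | blocking? B Y₂
  ... | yes Y₁-blocking | _ = inj₁ Y₁-blocking
  ... | no _ | yes Y₂-blocking = inj₂ Y₂-blocking
  ... | no ¬Y₁-blocking | no ¬Y₂-blocking with extend A Y₁ ¬Y₁-blocking | extend B Y₂ ¬Y₂-blocking
  ...   | S₁ , min₁ , Y₁⊆S₁ | S₂ , min₂ , Y₂⊆S₂ =
    ⊥-elim (blocking (S₁ ++ S₂) (min-cover-++ min₁ min₂) (++-⊆ Y₁⊆S₁ Y₂⊆S₂))

  minimal-blocking-++⁻ : ∀ {Y₁ Y₂} → IsMinimalBlocking (A ⊕ B) (Y₁ ++ Y₂) → Nonempty Y₁ →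
                         IsMinimalBlocking A Y₁ × Y₂ ≡ ⊥
  minimal-blocking-++⁻ {Y₁} {Y₂} (blocking , minimal) (a , a∈Y₁) with blocking-++⁻ blocking
  ... | inj₂ Y₂-blocking = ⊥-elim (minimal (⊥ ++ Y₂) ⊥++Y₂⊂ (blocking-++ʳ Y₂-blocking))
    where
    ⊥++Y₂⊂ : ⊥ ++ Y₂ ⊂ Y₁ ++ Y₂
    ⊥++Y₂⊂ = ++-⊆ (⊥-elim ∘ ∉⊥) id , a ↑ˡ n B , ↑ˡ∈++⁺ a∈Y₁ , λ a∈ → ∉⊥ (↑ˡ∈++⁻ {q = Y₂} a∈)
  ... | inj₁ Y₁-blocking = (Y₁-blocking , Y₁-minimal) , Empty-unique Y₂-empty
    where
    Y₁-minimal : ∀ Z → Z ⊂ Y₁ → ¬ IsBlocking A Z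
    Y₁-minimal Z (Z⊆ , a′ , a′∈ , a′∉) Z-blocking =
      minimal (Z ++ ⊥) (++-⊆ Z⊆ (⊥-elim ∘ ∉⊥) , a′ ↑ˡ n B , ↑ˡ∈++⁺ a′∈ ,
                        λ a′∈Z → a′∉ (↑ˡ∈++⁻ {q = ⊥} a′∈Z))
        (blocking-++ˡ Z-blocking)
    Y₂-empty : Empty Y₂
    Y₂-empty (c , c∈Y₂) =
      minimal (Y₁ ++ ⊥) (++-⊆ id (⊥-elim ∘ ∉⊥) , n A ↑ʳ c , ↑ʳ∈++⁺ c∈Y₂ ,
                         λ c∈ → ∉⊥ (↑ʳ∈++⁻ {p = Y₁} c∈))
        (blocking-++ˡ Y₁-blocking)

-- Cones: Cone H N is H together with a new vertex (zero) adjacent exactly to N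

coneAdj : (H : Graph) → Subset (n H) → Fin (suc (n H)) → Fin (suc (n H)) → Bool.Bool
coneAdj H N zero zero = false
coneAdj H N zero (suc j) = lookup N j
coneAdj H N (suc i) zero = lookup N i
coneAdj H N (suc i) (suc j) = adj H i j

Cone : (H : Graph) → Subset (n H) → Graph
Cone H N = record { n = suc (n H) ; adj = coneAdj H N ; adj-sym = sym′ ; adj-irr = irr }
  where
  sym′ : ∀ i j → coneAdj H N i j ≡ coneAdj H N j i
  sym′ zero zero = refl
  sym′ zero (suc j) = refl
  sym′ (suc i) zero = refl
  sym′ (suc i) (suc j) = adj-sym H i j
  irr : ∀ i → coneAdj H N i i ≡ false
  irr zero = refl
  irr (suc i) = adj-irr H i

cone-connected : ∀ H N → (∀ v → ∃ λ w → w ∈ N × Reach H v w) → Connected (Cone H N)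
cone-connected H N reaches-N = zero , λ u w → reach-trans (to-apex u) (reach-sym (to-apex w))
  where
  to-apex : ∀ v → Reach (Cone H N) v zero
  to-apex zero = here
  to-apex (suc v) with reaches-N v
  ... | w , w∈N , r = step (reach-map suc (λ _ _ e → e) r) ([]=⇒lookup w∈N)

module ConeCovers (H : Graph) (N : Subset (n H)) where
  K : Graph
  K = Cone H N

  cover-inside : ∀ {S} → IsVertexCover H S → IsVertexCover K (inside ∷ S)
  cover-inside cover zero (suc j) e = inj₁ here
  cover-inside cover (suc i) zero e = inj₂ here
  cover-inside cover (suc i) (suc j) e = Sum.map there there (cover i j e)

  cover-outside : ∀ {S} → IsVertexCover H S → N ⊆ S → IsVertexCover K (outside ∷ S)
  cover-outside cover N⊆S zero (suc j) e = inj₂ (there (N⊆S (lookup⇒[]= j N e)))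
  cover-outside cover N⊆S (suc i) zero e = inj₁ (there (N⊆S (lookup⇒[]= i N e)))
  cover-outside cover N⊆S (suc i) (suc j) e = Sum.map there there (cover i j e)

  cover-restrict : ∀ {x S} → IsVertexCover K (x ∷ S) → IsVertexCover H S
  cover-restrict cover i j e = Sum.map drop-there drop-there (cover (suc i) (suc j) e)

  cover-outside⁻ : ∀ {S} → IsVertexCover K (outside ∷ S) → N ⊆ S
  cover-outside⁻ cover {j} j∈N with cover zero (suc j) ([]=⇒lookup j∈N)
  ... | inj₂ j∈S = drop-there j∈S

  module ExpensiveNeighbourhood (S₀ : Subset (n H)) (S₀-min : IsMinVertexCover H S₀)
           (expensive : ∀ T → IsVertexCover H T → N ⊆ T → suc ∣ S₀ ∣ ≤ ∣ T ∣) where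
    min-cover-inside : ∀ {S} → IsMinVertexCover H S → IsMinVertexCover K (inside ∷ S)
    min-cover-inside {S} (cover , min) = cover-inside cover , minimum
      where
      minimum : ∀ T′ → IsVertexCover K T′ → ∣ inside ∷ S ∣ ≤ ∣ T′ ∣
      minimum (inside ∷ T) coverT = s≤s (min T (cover-restrict coverT))
      minimum (outside ∷ T) coverT =
        ≤-trans (s≤s (min S₀ (proj₁ S₀-min))) (expensive T (cover-restrict coverT) (cover-outside⁻ coverT))

    min-cover-outside : ∀ {T} → IsVertexCover H T → N ⊆ T → ∣ T ∣ ≤ suc ∣ S₀ ∣ →
                        IsMinVertexCover K (outside ∷ T)
    min-cover-outside cover N⊆T small =
      min-cover-≤ K (min-cover-inside S₀-min) (cover-outside cover N⊆T) small

    cone-min-size : ∀ {S′} → IsMinVertexCover K S′ → ∣ S′ ∣ ≡ suc ∣ S₀ ∣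
    cone-min-size min = min-cover-size K min (min-cover-inside S₀-min)

-- The two ways of enlarging a minimal blocking set Y of G, for a fixed y ∈ Y.
-- Let τ be the size of a minimum cover of G; covers containing Y have size > τ.

apex-extension : ∀ {G Y y} → IsMinimalBlocking G Y → y ∈ Y →
                 IsMinimalBlocking (Cone G Y) (inside ∷ Y)
apex-extension {G} {Y} {y} minimal y∈Y = blocking , minimality
  where
  open CriticalCovers G minimal
  open ConeCovers G Y
  open ExpensiveNeighbourhood (minus-cover y∈Y) (minus-cover-min y∈Y) (⊇Y⇒larger y∈Y)

  -- a minimum cover of the cone has size τ + 1, too small to contain Y and the apex
  blocking : IsBlocking K (inside ∷ Y)
  blocking (outside ∷ T) min Y′⊆ with Y′⊆ here
  ... | ()
  blocking (inside ∷ T) min Y′⊆ = 1+n≰n (subst (_≤ ∣ T ∣) (sym (cone-min-size min))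
    (⊇Y⇒larger y∈Y T (cover-restrict (proj₁ min)) (drop-there ∘ Y′⊆ ∘ there)))

  -- dropping the apex, use plus-cover y without the apex;
  -- dropping z ∈ Y, use minus-cover z together with the apex
  minimality : ∀ Z → Z ⊂ inside ∷ Y → ¬ IsBlocking K Z
  minimality Z (Z⊆Y′ , zero , _ , apex∉Z) Z-blocking =
    Z-blocking _ (min-cover-outside (plus-cover-is-cover y∈Y) (plus-cover-⊇ y∈Y) (plus-cover-size y∈Y)) Z⊆
    where
    Z⊆ : Z ⊆ outside ∷ plus-cover y∈Y
    Z⊆ {zero} apex∈Z = ⊥-elim (apex∉Z apex∈Z)
    Z⊆ {suc i} i∈Z = there (plus-cover-⊇ y∈Y (drop-there (Z⊆Y′ i∈Z)))
  minimality Z (Z⊆Y′ , suc z , z∈Y′ , z∉Z) Z-blocking =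
    Z-blocking _ (min-cover-inside (minus-cover-min (drop-there z∈Y′))) Z⊆
    where
    Z⊆ : Z ⊆ inside ∷ minus-cover (drop-there z∈Y′)
    Z⊆ {zero} _ = here
    Z⊆ {suc i} i∈Z with i Fin.≟ z
    ... | yes refl = ⊥-elim (z∉Z i∈Z)
    ... | no i≢z = there (minus-cover-⊇ (drop-there z∈Y′) (drop-there (Z⊆Y′ i∈Z)) i≢z)

doubling-extension : ∀ {G Y y} → IsMinimalBlocking G Y → y ∈ Y →
                     IsMinimalBlocking (Cone (G ⊕ G) (Y ++ ⁅ y ⁆)) (outside ∷ (Y ++ (Y - y)))
doubling-extension {G} {Y} {y} minimal y∈Y = blocking , minimality
  where
  open CriticalCovers G minimal
  open DisjointUnion G G
  open ConeCovers (G ⊕ G) (Y ++ ⁅ y ⁆)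

  τ : ℕ
  τ = ∣ minus-cover y∈Y ∣

  min-cover-G : ∀ T → IsVertexCover G T → τ ≤ ∣ T ∣
  min-cover-G = proj₂ (minus-cover-min y∈Y)

  S₀ : Subset (n G + n G)
  S₀ = minus-cover y∈Y ++ minus-cover y∈Y

  ∣S₀∣≡2τ : ∣ S₀ ∣ ≡ τ + τ
  ∣S₀∣≡2τ = ∣p++q∣ (minus-cover y∈Y) (minus-cover y∈Y)

  size-1 : ∀ {T₁ T₂} → IsVertexCover (G ⊕ G) (T₁ ++ T₂) → Y ⊆ T₁ → suc (τ + τ) ≤ ∣ T₁ ++ T₂ ∣
  size-1 {T₁} {T₂} cover Y⊆T₁ = subst (_ ≤_) (sym (∣p++q∣ T₁ T₂))
    (+-mono-≤ (⊇Y⇒larger y∈Y T₁ (cover-++⁻ˡ {T₁} cover) Y⊆T₁) (min-cover-G T₂ (cover-++⁻ʳ {T₁} cover)))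

  size-2 : ∀ {T₁ T₂} → IsVertexCover (G ⊕ G) (T₁ ++ T₂) → Y ⊆ T₁ → Y ⊆ T₂ →
           suc τ + suc τ ≤ ∣ T₁ ++ T₂ ∣
  size-2 {T₁} {T₂} cover Y⊆T₁ Y⊆T₂ = subst (_ ≤_) (sym (∣p++q∣ T₁ T₂))
    (+-mono-≤ (⊇Y⇒larger y∈Y T₁ (cover-++⁻ˡ {T₁} cover) Y⊆T₁)
              (⊇Y⇒larger y∈Y T₂ (cover-++⁻ʳ {T₁} cover) Y⊆T₂))

  expensive : ∀ T → IsVertexCover (G ⊕ G) T → Y ++ ⁅ y ⁆ ⊆ T → suc ∣ S₀ ∣ ≤ ∣ T ∣
  expensive T cover N⊆T with Vec.splitAt (n G) T
  ... | T₁ , T₂ , refl = subst (_≤ ∣ T₁ ++ T₂ ∣) (cong suc (sym ∣S₀∣≡2τ))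
                           (size-1 cover (λ a∈ → ↑ˡ∈++⁻ {q = T₂} (N⊆T (↑ˡ∈++⁺ a∈))))

  open ExpensiveNeighbourhood S₀ (min-cover-++ (minus-cover-min y∈Y) (minus-cover-min y∈Y)) expensive

  -- a minimum cover of the cone has size 2τ + 1, but containing the blocking set
  -- costs 2τ + 1 without the apex and 2τ + 2 with it
  blocking : IsBlocking K (outside ∷ (Y ++ (Y - y)))
  blocking (inside ∷ T) min Y′⊆ with Vec.splitAt (n G) T
  ... | T₁ , T₂ , refl =
    1+n≰n (subst (suc (τ + τ) ≤_) ∣T∣≡2τ (size-1 (cover-restrict (proj₁ min)) Y⊆T₁))
    where
    ∣T∣≡2τ : ∣ T₁ ++ T₂ ∣ ≡ τ + τ
    ∣T∣≡2τ = trans (suc-injective (cone-min-size min)) ∣S₀∣≡2τ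
    Y⊆T₁ : Y ⊆ T₁
    Y⊆T₁ a∈ = ↑ˡ∈++⁻ {q = T₂} (drop-there (Y′⊆ (there (↑ˡ∈++⁺ a∈))))
  blocking (outside ∷ T) min Y′⊆ with Vec.splitAt (n G) T
  ... | T₁ , T₂ , refl = 1+n≰n (begin
      suc (suc (τ + τ))  ≡⟨ cong suc (sym (+-suc τ τ)) ⟩
      suc τ + suc τ      ≤⟨ size-2 (cover-restrict (proj₁ min)) Y⊆T₁ Y⊆T₂ ⟩
      ∣ T₁ ++ T₂ ∣       ≡⟨ trans (cone-min-size min) (cong suc ∣S₀∣≡2τ) ⟩
      suc (τ + τ)        ∎)
    where
    open ≤-Reasoning
    Y⊆T₁ : Y ⊆ T₁
    Y⊆T₁ a∈ = ↑ˡ∈++⁻ {q = T₂} (drop-there (Y′⊆ (there (↑ˡ∈++⁺ a∈))))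
    Y⊆T₂ : Y ⊆ T₂
    Y⊆T₂ {a} a∈ with a Fin.≟ y
    ... | yes refl = ↑ʳ∈++⁻ {p = T₁} (cover-outside⁻ (proj₁ min) (↑ʳ∈++⁺ {p = Y} (x∈⁅x⁆ y)))
    ... | no a≢y = ↑ʳ∈++⁻ {p = T₁} (drop-there (Y′⊆ (there (↑ʳ∈++⁺ {p = Y} (x∈p∧x≢y⇒x∈p-y a∈ a≢y)))))

  -- dropping a from the first copy, use minus-cover a on the first copy and
  -- minus-cover y on the second, with the apex; dropping a from the second copy,
  -- use plus-cover y on the first copy and minus-cover a on the second, without it
  minimality : ∀ Z → Z ⊂ outside ∷ (Y ++ (Y - y)) → ¬ IsBlocking K Z
  minimality Z (Z⊆Y′ , zero , () , _)
  minimality Z (Z⊆Y′ , suc x , x∈Y′ , x∉Z) Z-blocking with half (n G) x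
  ... | left a =
    Z-blocking _ (min-cover-inside (min-cover-++ (minus-cover-min a∈Y) (minus-cover-min y∈Y))) Z⊆
    where
    a∈Y : a ∈ Y
    a∈Y = ↑ˡ∈++⁻ {q = Y - y} (drop-there x∈Y′)
    Z⊆ : Z ⊆ inside ∷ (minus-cover a∈Y ++ minus-cover y∈Y)
    Z⊆ {zero} _ = here
    Z⊆ {suc i} i∈Z with Z⊆Y′ i∈Z | half (n G) i
    ... | there i∈ | right c = there (↑ʳ∈++⁺ (minus-cover-⊇ y∈Y (p─q⊆p Y ⁅ y ⁆ c∈Y-y) (x∈p-y⇒x≢y c∈Y-y)))
      where
      c∈Y-y : c ∈ Y - y
      c∈Y-y = ↑ʳ∈++⁻ {p = Y} i∈
    ... | there i∈ | left c with c Fin.≟ a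
    ...   | yes refl = ⊥-elim (x∉Z i∈Z)
    ...   | no c≢a = there (↑ˡ∈++⁺ (minus-cover-⊇ a∈Y (↑ˡ∈++⁻ {q = Y - y} i∈) c≢a))
  ... | right a = Z-blocking _ (min-cover-outside cover N⊆ small) Z⊆
    where
    a∈Y-y : a ∈ Y - y
    a∈Y-y = ↑ʳ∈++⁻ {p = Y} (drop-there x∈Y′)
    a∈Y : a ∈ Y
    a∈Y = p─q⊆p Y ⁅ y ⁆ a∈Y-y
    cover : IsVertexCover (G ⊕ G) (plus-cover y∈Y ++ minus-cover a∈Y)
    cover = cover-++ (plus-cover-is-cover y∈Y) (proj₁ (minus-cover-min a∈Y))
    N⊆ : Y ++ ⁅ y ⁆ ⊆ plus-cover y∈Y ++ minus-cover a∈Y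
    N⊆ = ++-⊆ (plus-cover-⊇ y∈Y) λ c∈ → subst (_∈ minus-cover a∈Y) (sym (x∈⁅y⁆⇒x≡y y c∈))
           (minus-cover-⊇ a∈Y y∈Y (λ y≡a → x∈p-y⇒x≢y a∈Y-y (sym y≡a)))
    small : ∣ plus-cover y∈Y ++ minus-cover a∈Y ∣ ≤ suc ∣ S₀ ∣
    small = begin
      ∣ plus-cover y∈Y ++ minus-cover a∈Y ∣     ≡⟨ ∣p++q∣ (plus-cover y∈Y) (minus-cover a∈Y) ⟩
      ∣ plus-cover y∈Y ∣ + ∣ minus-cover a∈Y ∣  ≤⟨ +-mono-≤ (plus-cover-size y∈Y)
                                                              (≤-reflexive (minus-cover-size a∈Y y∈Y)) ⟩
      suc τ + τ                                 ≡⟨ cong suc ∣S₀∣≡2τ ⟨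
      suc ∣ S₀ ∣                                ∎
      where open ≤-Reasoning
    Z⊆ : Z ⊆ outside ∷ (plus-cover y∈Y ++ minus-cover a∈Y)
    Z⊆ {zero} i∈Z with Z⊆Y′ i∈Z
    ... | ()
    Z⊆ {suc i} i∈Z with Z⊆Y′ i∈Z | half (n G) i
    ... | there i∈ | left c = there (↑ˡ∈++⁺ (plus-cover-⊇ y∈Y (↑ˡ∈++⁻ {q = Y - y} i∈)))
    ... | there i∈ | right c with c Fin.≟ a
    ...   | yes refl = ⊥-elim (x∉Z i∈Z)
    ...   | no c≢a = there (↑ʳ∈++⁺ (minus-cover-⊇ a∈Y (p─q⊆p Y ⁅ y ⁆ (↑ʳ∈++⁻ {p = Y} i∈)) c≢a))

doubling-size : ∀ {m} (Y : Subset m) y → ∣ Y ∣ + ∣ Y ∣ ≤ suc ∣ Y ++ (Y - y) ∣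
doubling-size Y y = begin
  ∣ Y ∣ + ∣ Y ∣            ≤⟨ +-monoʳ-≤ ∣ Y ∣ (∣p∣≤1+∣p-x∣ Y y) ⟩
  ∣ Y ∣ + suc ∣ Y - y ∣    ≡⟨ +-suc ∣ Y ∣ ∣ Y - y ∣ ⟩
  suc (∣ Y ∣ + ∣ Y - y ∣)  ≡⟨ cong suc (sym (∣p++q∣ Y (Y - y))) ⟩
  suc ∣ Y ++ (Y - y) ∣     ∎
  where open ≤-Reasoning

injective-missing⇒< : ∀ {k m} (g : Fin k → Fin m) → Injective _≡_ _≡_ g →
                      (w : Fin m) → (∀ i → g i ≢ w) → k < m
injective-missing⇒< {m = suc m} g g-inj w missed =
  s≤s (Fin.injective⇒≤ {f = λ i → punchOut (missed i ∘ sym)}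
        λ e → g-inj (Fin.punchOut-injective (missed _ ∘ sym) (missed _ ∘ sym) e))

lift-reach : ∀ G {k} {f : Fin k → Vertex G} {P : Vertex G → Set} → Enumerates G f P →
             (∀ a b → P a → Edge G a b → P b) →
             ∀ {i z} → Reach G (f i) z → ∃ λ j → f j ≡ z × Reach (Induced G f) i j
lift-reach G en closed {i} here = i , refl , here
lift-reach G {f = f} en closed (step r e) with lift-reach G en closed r
... | j , refl , r′ with index en (closed _ _ (enumerated en j) e)
...   | j′ , fj′≡ = j′ , fj′≡ , step r′ (trans (cong (adj G (f j)) fj′≡) e)

reach-closed : ∀ G (u : Vertex G) a b → Reach G u a → Edge G a b → Reach G u b
reach-closed G u a b r e = step r e

unreach-closed : ∀ G (u : Vertex G) a b → ¬ Reach G u a → Edge G a b → ¬ Reach G u b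
unreach-closed G u a b ¬r e r = ¬r (step r (edge-sym G e))

component-connected : ∀ G {y : Vertex G} {k} {f : Fin k → Vertex G} →
                      Enumerates G f (Reach G y) → ∀ {a} → f a ≡ y → Connected (Induced G f)
component-connected G {y} {f = f} en {a} fa≡y =
  a , λ u w → reach-trans (reach-sym (from-a u)) (from-a w)
  where
  from-a : ∀ j → Reach (Induced G f) a j
  from-a j with lift-reach G en (reach-closed G y)
                  (subst (λ x → Reach G x (f j)) (sym fa≡y) (enumerated en j))
  ... | j′ , fj′≡fj , r = subst (Reach (Induced G f) a) (proj₁ en fj′≡fj) r

component-in-part : ∀ G {P : Vertex G → Set} {l} {g : Fin l → Vertex G} → Enumerates G g P →
                    (∀ a b → P a → Edge G a b → P b) →
                    ∀ {y′ k k′} {f : Fin k → Vertex G} {f′ : Fin k′ → Fin l} →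
                    Enumerates G f (Reach G (g y′)) → EnumeratesFin l f′ (Reach (Induced G g) y′) →
                    Induced G (g ∘ f′) ≅ Induced G f
component-in-part G {g = g} g-enum closed {f′ = f′} f-enum f′-enum =
  ≅-enumerations G g∘f′-enum f-enum
    (λ { v (i , refl) → reach-map g (λ _ _ e → e) (enumerated f′-enum i) })
    (λ v y⇝v → let j , gj≡v , r = lift-reach G g-enum closed y⇝v
                   i , f′i≡j = index f′-enum r
               in i , trans (cong g f′i≡j) gj≡v)
  where
  g∘f′-enum : Enumerates G (g ∘ f′) (λ v → ∃ λ i → g (f′ i) ≡ v)
  g∘f′-enum = proj₁ f′-enum ∘ proj₁ g-enum , λ v → id , id

module Components {C : Graph → Set} (iso-closed : GraphClass C) (robust : Robust C) where
  -- The component of y in a member G of C is again a member: if some w does not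
  -- reach y, delete the component of w (a member of C by robustness, with fewer
  -- vertices) and recurse; otherwise the component is all of G.  The recursion is
  -- on an upper bound for the number of vertices.
  component∈C : ∀ bound G → n G ≤ bound → C G → ∀ y {k} {f : Fin k → Vertex G} →
                Enumerates G f (Reach G y) → C (Induced G f)
  component∈C bound G small G∈C y {f = f} en with Fin.all? (reach? G y)
  ... | yes all-reach = iso-closed G (Induced G f) (≅-sym whole) G∈C
    where
    everything : Enumerates G id (λ _ → ⊤)
    everything = id , λ v → (λ _ → v , refl) , (λ _ → tt)
    -- Induced G id is G itself
    whole : Induced G f ≅ Induced G id
    whole = ≅-enumerations G en everything (λ _ _ → tt) (λ v _ → all-reach v)
  ... | no ¬all-reach with Fin.¬∀⟶∃¬ (n G) (Reach G y) (reach? G y) ¬all-reach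
  component∈C zero G small G∈C y en | no _ | w , _ with () ← ≤-trans (Fin.toℕ<n w) small
  component∈C (suc bound) G small G∈C y en | no _ | w , ¬y⇝w
    with enumerate (λ v → ¬ Reach G w v) (λ v → ¬? (reach? G w v))
  ... | l , g , g-enum with index g-enum {y} (¬y⇝w ∘ reach-sym)
  ... | y′ , refl with enumerate (Reach (Induced G g) y′) (reach? (Induced G g) y′)
  ... | _ , f′ , f′-enum =
    iso-closed _ _ (component-in-part G g-enum (unreach-closed G w) en f′-enum)
      (component∈C bound (Induced G g) fewer rest∈C y′ f′-enum)
    where
    rest∈C : C (Induced G g)
    rest∈C = proj₂ robust G _ G∈C (w , l , g , g-enum , refl)
    fewer : l ≤ bound
    fewer = ≤-pred (≤-trans (injective-missing⇒< g (proj₁ g-enum) w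
              (λ i gi≡w → enumerated g-enum i (subst (Reach G w) (sym gi≡w) here))) small)

  connected-witness : ∀ G → C G → ∀ {Y} → IsMinimalBlocking G Y → Nonempty Y →
    Σ Graph λ G* → C G* × Connected G* ×
      Σ (Subset (n G*)) λ Y* → IsMinimalBlocking G* Y* × ∣ Y* ∣ ≡ ∣ Y ∣
  connected-witness G G∈C {Y} minimal (y , y∈Y)
    with enumerate (Reach G y) (reach? G y) | enumerate (λ v → ¬ Reach G y v) (λ v → ¬? (reach? G y v))
  ... | k , f , f-enum | l , g , g-enum =
    Induced G f , component∈C (n G) G ≤-refl G∈C y f-enum ,
    component-connected G f-enum (proj₂ (index f-enum here)) , restriction
    where
    split : (Induced G f ⊕ Induced G g) ≅ G
    split = ≅-split G (reach? G y) (reach-closed G y) f-enum g-enum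
    a : Fin k
    a = proj₁ (index f-enum here)
    a∈ : a ↑ˡ l ∈ pull split Y
    a∈ = ∈pull⁺ split (subst (_∈ Y) (sym to-a≡y) y∈Y)
      where
      to-a≡y : to split (a ↑ˡ l) ≡ y
      to-a≡y = trans (cong [ f , g ] (Fin.splitAt-↑ˡ k a l)) (proj₂ (index f-enum here))
    restriction : Σ (Subset k) λ Y₁ → IsMinimalBlocking (Induced G f) Y₁ × ∣ Y₁ ∣ ≡ ∣ Y ∣
    restriction with Vec.splitAt k (pull split Y)
    ... | Y₁ , Y₂ , eq
      with DisjointUnion.minimal-blocking-++⁻ (Induced G f) (Induced G g)
             (subst (IsMinimalBlocking (Induced G f ⊕ Induced G g)) eq (pull-minimal-blocking split minimal))
             (a , ↑ˡ∈++⁻ {q = Y₂} (subst (a ↑ˡ l ∈_) eq a∈))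
    ... | Y₁-minimal , refl =
      Y₁ , Y₁-minimal , trans (sym (∣p++⊥∣ l Y₁)) (trans (cong ∣_∣ (sym eq)) (∣pull∣ split Y))

enumerates-cong : ∀ {m k} {f : Fin k → Fin m} {P Q : Fin m → Set} → EnumeratesFin m f P →
                  (∀ v → P v → Q v) → (∀ v → Q v → P v) → EnumeratesFin m f Q
enumerates-cong en P⇒Q Q⇒P = proj₁ en , λ v → (proj₁ (proj₂ en v) ∘ Q⇒P v) , (P⇒Q v ∘ proj₂ (proj₂ en v))

enumerates-≅ : ∀ {G H} (I : G ≅ H) {k} {f : Fin k → Vertex H} {P : Vertex H → Set} →
               Enumerates H f P → Enumerates G (from I ∘ f) (P ∘ to I)
enumerates-≅ I {f = f} {P} en = proj₁ en ∘ to-injective (≅-sym I) , en′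
  where
  en′ : ∀ v → (P (to I v) → ∃ λ i → from I (f i) ≡ v) × ((∃ λ i → from I (f i) ≡ v) → P (to I v))
  en′ v = (λ P-v → let i , fi≡ = index en P-v in i , trans (cong (from I) fi≡) (from-to I v))
        , λ { (i , refl) → subst P (sym (to-from I (f i))) (enumerated en i) }

≅-EdLe : ∀ {C} → GraphClass C → ∀ {G H d} → G ≅ H → EdLe C G d → EdLe C H d
≅-EdLe iso-closed I (inClass G∈C) = inClass (iso-closed _ _ I G∈C)
≅-EdLe iso-closed {G} {H} I (delete G∉C conn v σ σ-enum ed) =
  delete (G∉C ∘ iso-closed _ _ (≅-sym I)) (≅-connected I conn) (to I v) (to I ∘ σ)
    (enumerates-cong (enumerates-≅ (≅-sym I) σ-enum)
       (λ w w≢ w≡ → w≢ (trans (cong (from I) w≡) (from-to I v)))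
       (λ w w≢ w≡ → w≢ (trans (sym (to-from I w)) (cong (to I) w≡))))
    (≅-EdLe iso-closed (relabel {G} {H} σ (to I ∘ σ) (λ i j → _≅_.preserve I (σ i) (σ j))) ed)
≅-EdLe iso-closed {G} {H} I (componentwise G∉C ¬conn components) =
  componentwise (G∉C ∘ iso-closed _ _ (≅-sym I)) (¬conn ∘ ≅-connected (≅-sym I)) components′
  where
  components′ : ∀ H′ → IsComponentOf H′ H → EdLe _ H′ _
  components′ _ (u , k , f , f-enum , refl) =
    ≅-EdLe iso-closed (relabel {G} {H} (from I ∘ f) f (λ i j → sym (_≅_.preserve (≅-sym I) (f i) (f j))))
      (components _ (from I u , k , from I ∘ f , component , refl))
    where
    component : Enumerates G (from I ∘ f) (Reach G (from I u))
    component = enumerates-cong (enumerates-≅ I f-enum)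
      (λ v r → subst (Reach G (from I u)) (from-to I v) (≅-reach (≅-sym I) r))
      (λ v r → subst (λ x → Reach H x (to I v)) (to-from I u) (≅-reach I r))

apex-deletion : ∀ {H N} → Enumerates (Cone H N) suc (λ w → ¬ w ≡ zero)
apex-deletion = Fin.suc-injective , λ
  { zero → (λ 0≢0 → ⊥-elim (0≢0 refl)) , λ { (_ , ()) }
  ; (suc w) → (λ _ → w , refl) , λ _ () }

cone-EdLe : ∀ {C H N d} → EdLe C H d → Connected (Cone H N) → ¬ C (Cone H N) → EdLe C (Cone H N) (suc d)
cone-EdLe {H = H} {N} ed conn cone∉C = delete cone∉C conn zero suc (apex-deletion {H} {N}) ed

true≢false : true ≢ false
true≢false ()

module ConnectedSummands (A B : Graph) (A-conn : Connected A) (B-conn : Connected B) where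
  open DisjointUnion A B using (edgeˡ; edgeʳ; no-edge)

  side : Fin (n A + n B) → Bool.Bool
  side x = [ const true , const false ] (splitAt (n A) x)

  side-↑ˡ : ∀ a → side (a ↑ˡ n B) ≡ true
  side-↑ˡ a rewrite Fin.splitAt-↑ˡ (n A) a (n B) = refl

  side-↑ʳ : ∀ c → side (n A ↑ʳ c) ≡ false
  side-↑ʳ c rewrite Fin.splitAt-↑ʳ (n A) (n B) c = refl

  reach-side : ∀ {u w} → Reach (A ⊕ B) u w → side u ≡ side w
  reach-side here = refl
  reach-side (step {v} {w} r e) = trans (reach-side r) (edge-side v w e)
    where
    edge-side : ∀ v w → Edge (A ⊕ B) v w → side v ≡ side w
    edge-side v w e with half (n A) v | half (n A) w
    ... | left a | left a′ = trans (side-↑ˡ a) (sym (side-↑ˡ a′))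
    ... | right c | right c′ = trans (side-↑ʳ c) (sym (side-↑ʳ c′))
    ... | left a | right c = ⊥-elim (no-edge a c e)
    ... | right c | left a = ⊥-elim (no-edge a c (edge-sym (A ⊕ B) e))

  left-reach : ∀ a a′ → Reach (A ⊕ B) (a ↑ˡ n B) (a′ ↑ˡ n B)
  left-reach a a′ = reach-map (_↑ˡ n B) (λ a a′ e → trans (edgeˡ a a′) e) (proj₂ A-conn a a′)

  right-reach : ∀ c c′ → Reach (A ⊕ B) (n A ↑ʳ c) (n A ↑ʳ c′)
  right-reach c c′ = reach-map (n A ↑ʳ_) (λ c c′ e → trans (edgeʳ c c′) e) (proj₂ B-conn c c′)

  same-side⇒reach : ∀ u w → side u ≡ side w → Reach (A ⊕ B) u w
  same-side⇒reach u w same with half (n A) u | half (n A) w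
  ... | left a | left a′ = left-reach a a′
  ... | right c | right c′ = right-reach c c′
  ... | left a | right c = ⊥-elim (true≢false (trans (sym (side-↑ˡ a)) (trans same (side-↑ʳ c))))
  ... | right c | left a = ⊥-elim (true≢false (trans (sym (side-↑ˡ a)) (trans (sym same) (side-↑ʳ c))))

  a₀ : Vertex A
  a₀ = proj₁ A-conn

  c₀ : Vertex B
  c₀ = proj₁ B-conn

  not-connected : ¬ Connected (A ⊕ B)
  not-connected (_ , conn) =
    true≢false (trans (sym (side-↑ˡ a₀)) (trans (reach-side (conn _ _)) (side-↑ʳ c₀)))

  left-enum : Enumerates (A ⊕ B) (_↑ˡ n B) (λ w → side w ≡ true)
  left-enum = (λ {a} {a′} → Fin.↑ˡ-injective (n B) a a′) , λ w → onLeft w , λ { (a , refl) → side-↑ˡ a }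
    where
    onLeft : ∀ w → side w ≡ true → ∃ λ a → a ↑ˡ n B ≡ w
    onLeft w left-side with half (n A) w
    ... | left a = a , refl
    ... | right c = ⊥-elim (true≢false (trans (sym left-side) (side-↑ʳ c)))

  right-enum : Enumerates (A ⊕ B) (n A ↑ʳ_) (λ w → side w ≡ false)
  right-enum = (λ {c} {c′} → Fin.↑ʳ-injective (n A) c c′) , λ w → onRight w , λ { (c , refl) → side-↑ʳ c }
    where
    onRight : ∀ w → side w ≡ false → ∃ λ c → n A ↑ʳ c ≡ w
    onRight w right-side with half (n A) w
    ... | right c = c , refl
    ... | left a = ⊥-elim (true≢false (trans (sym (side-↑ˡ a)) right-side))

  left≅ : Induced (A ⊕ B) (_↑ˡ n B) ≅ A
  left≅ = mkIso id id (λ _ → refl) (λ _ → refl) (λ a a′ → sym (edgeˡ a a′))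

  right≅ : Induced (A ⊕ B) (n A ↑ʳ_) ≅ B
  right≅ = mkIso id id (λ _ → refl) (λ _ → refl) (λ c c′ → sym (edgeʳ c c′))

  component≅ : ∀ H → IsComponentOf H (A ⊕ B) → H ≅ A ⊎ H ≅ B
  component≅ H (u , k , f , f-enum , refl) with side u in side-u
  ... | true = inj₁ (≅-trans (≅-enumerations (A ⊕ B) f-enum left-enum
          (λ v r → trans (sym (reach-side r)) side-u)
          (λ v side-v → same-side⇒reach u v (trans side-u (sym side-v)))) left≅)
  ... | false = inj₂ (≅-trans (≅-enumerations (A ⊕ B) f-enum right-enum
          (λ v r → trans (sym (reach-side r)) side-u)
          (λ v side-v → same-side⇒reach u v (trans side-u (sym side-v)))) right≅)

  -- deleting the component of B leaves A, so A ⊕ B ∉ C whenever A ∉ C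
  ∉C : ∀ {C : Graph → Set} → GraphClass C → Robust C → ¬ C A → ¬ C (A ⊕ B)
  ∉C iso-closed robust A∉C A⊕B∈C =
    A∉C (iso-closed _ A left≅ (proj₂ robust (A ⊕ B) _ A⊕B∈C (n A ↑ʳ c₀ , n A , _↑ˡ n B , deletion , refl)))
    where
    deletion : Enumerates (A ⊕ B) (_↑ˡ n B) (λ w → ¬ Reach (A ⊕ B) (n A ↑ʳ c₀) w)
    deletion = enumerates-cong left-enum
      (λ w left-side r → true≢false (trans (sym left-side) (trans (sym (reach-side r)) (side-↑ʳ c₀))))
      (λ w ¬r → ¬-not (λ right-side → ¬r (same-side⇒reach _ w (trans (side-↑ʳ c₀) (sym right-side)))))

  ⊕-EdLe : ∀ {C d} → GraphClass C → Robust C → ¬ C A → EdLe C A d → EdLe C B d → EdLe C (A ⊕ B) d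
  ⊕-EdLe iso-closed robust A∉C A-ed B-ed =
    componentwise (∉C iso-closed robust A∉C) not-connected λ H component →
      [ (λ H≅A → ≅-EdLe iso-closed (≅-sym H≅A) A-ed) , (λ H≅B → ≅-EdLe iso-closed (≅-sym H≅B) B-ed) ]
        (component≅ H component)

double-power : ∀ X → suc (2 * X + 1) ≡ (X + 1) + (X + 1)
double-power = solve-∀

double-scaled : ∀ a X → suc (a * (2 * X) + 1) ≡ (a * X + 1) + (a * X + 1)
double-scaled = solve-∀

first-doubling : ∀ b → 1 ≤ b → suc ((b ∸ 1) * 2 + 1) ≡ b + b
first-doubling (suc a) _ = identity a
  where
  identity : ∀ a → suc (a * 2 + 1) ≡ suc a + suc a
  identity = solve-∀

module Iteration (C : Graph → Set) (iso-closed : GraphClass C) (robust : Robust C)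
                 (b : ℕ) (β-bound : ∀ G → C G → BetaLe G b) where

  -- a connected graph with ed_C ≤ d and a minimal blocking set of size ≥ K, which
  -- is too large for the graph to lie in C
  record Witness (d K : ℕ) : Set where
    field
      graph    : Graph
      ed       : EdLe C graph d
      conn     : Connected graph
      blocker  : Subset (n graph)
      minimal  : IsMinimalBlocking graph blocker
      large    : K ≤ ∣ blocker ∣
      beyond-b : b < ∣ blocker ∣

  witness⇒β : ∀ {d K} → Witness d K → BetaEdGe C d K
  witness⇒β w = graph , ed , inj₂ (blocker , minimal , large)
    where open Witness w

  weaken : ∀ {d K K′} → K′ ≤ K → Witness d K → Witness d K′
  weaken K′≤K w = record { graph = graph ; ed = ed ; conn = conn ; blocker = blocker ; minimal = minimal
                         ; large = ≤-trans K′≤K large ; beyond-b = beyond-b }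
    where open Witness w

  ∉C : ∀ {G Y} → IsMinimalBlocking G Y → b < ∣ Y ∣ → ¬ C G
  ∉C {G} {Y} minimal b<∣Y∣ G∈C = <⇒≱ b<∣Y∣ (β-bound G G∈C Y minimal)

  apex-step : ∀ {G Y} → Connected G → C G → IsMinimalBlocking G Y → Nonempty Y → b ≤ ∣ Y ∣ →
              Witness 1 (suc ∣ Y ∣)
  apex-step {G} {Y} conn G∈C minimal (y , y∈Y) b≤∣Y∣ = record
    { graph = Cone G Y ; ed = cone-EdLe (inClass G∈C) cone-conn (∉C minimal′ (s≤s b≤∣Y∣))
    ; conn = cone-conn ; blocker = inside ∷ Y ; minimal = minimal′
    ; large = ≤-refl ; beyond-b = s≤s b≤∣Y∣ }
    where
    minimal′ : IsMinimalBlocking (Cone G Y) (inside ∷ Y)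
    minimal′ = apex-extension minimal y∈Y
    cone-conn : Connected (Cone G Y)
    cone-conn = cone-connected G Y (λ v → y , y∈Y , proj₂ conn v y)

  doubling-step : ∀ {G Y d} → Connected G → EdLe C (G ⊕ G) d → IsMinimalBlocking G Y → Nonempty Y →
                  suc (suc b) ≤ ∣ Y ∣ + ∣ Y ∣ → ∀ K → suc K ≤ ∣ Y ∣ + ∣ Y ∣ → Witness (suc d) K
  doubling-step {G} {Y} conn ed minimal (y , y∈Y) b-small K K-small = record
    { graph = Cone (G ⊕ G) N ; ed = cone-EdLe ed cone-conn (∉C minimal′ beyond-b)
    ; conn = cone-conn ; blocker = outside ∷ Y′ ; minimal = minimal′
    ; large = ≤-pred (≤-trans K-small size) ; beyond-b = beyond-b }
    where
    open ConnectedSummands G G conn conn using (left-reach; right-reach)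
    N : Subset (n G + n G)
    N = Y ++ ⁅ y ⁆
    Y′ : Subset (n G + n G)
    Y′ = Y ++ (Y - y)
    minimal′ : IsMinimalBlocking (Cone (G ⊕ G) N) (outside ∷ Y′)
    minimal′ = doubling-extension minimal y∈Y
    size : ∣ Y ∣ + ∣ Y ∣ ≤ suc ∣ Y′ ∣
    size = doubling-size Y y
    beyond-b : b < ∣ Y′ ∣
    beyond-b = ≤-pred (≤-trans b-small size)
    cone-conn : Connected (Cone (G ⊕ G) N)
    cone-conn = cone-connected (G ⊕ G) N reaches-N
      where
      reaches-N : ∀ v → ∃ λ w → w ∈ N × Reach (G ⊕ G) v w
      reaches-N v with half (n G) v
      ... | left a = y ↑ˡ n G , ↑ˡ∈++⁺ y∈Y , left-reach a y
      ... | right c = n G ↑ʳ y , ↑ʳ∈++⁺ {p = Y} (x∈⁅x⁆ y) , right-reach c y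

  grow : ∀ {d K} → Witness d K → ∀ K′ → suc K′ ≤ K + K → Witness (suc d) K′
  grow w K′ K′-small =
    doubling-step conn (ConnectedSummands.⊕-EdLe graph graph conn conn iso-closed robust G∉C ed ed)
      minimal (∣p∣>0⇒nonempty blocker (≤-trans (s≤s z≤n) beyond-b))
      b-small K′ (≤-trans K′-small (+-mono-≤ large large))
    where
    open Witness w
    G∉C : ¬ C graph
    G∉C = ∉C minimal beyond-b
    b-small : suc (suc b) ≤ ∣ blocker ∣ + ∣ blocker ∣
    b-small = ≤-trans (s≤s (m≤n+m (suc b) b)) (+-mono-≤ beyond-b beyond-b)

  record Seed : Set where
    field
      graph   : Graph
      member  : C graph
      conn    : Connected graph
      blocker : Subset (n graph)
      minimal : IsMinimalBlocking graph blocker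
      large   : b ≤ ∣ blocker ∣

  seed : (∃ λ G → C G × BetaGe G b) → 1 ≤ b → Seed
  seed (G , G∈C , inj₁ refl) ()
  seed (G , G∈C , inj₂ (Y , minimal , b≤∣Y∣)) 1≤b =
    from-component (Components.connected-witness iso-closed robust G G∈C minimal
                     (∣p∣>0⇒nonempty Y (≤-trans 1≤b b≤∣Y∣)))
    where
    from-component : (Σ Graph λ G* → C G* × Connected G* ×
                        Σ (Subset (n G*)) λ Y* → IsMinimalBlocking G* Y* × ∣ Y* ∣ ≡ ∣ Y ∣) → Seed
    from-component (G* , G*∈C , conn , Y* , minimal* , ∣Y*∣≡∣Y∣) =
      record { graph = G* ; member = G*∈C ; conn = conn ; blocker = Y* ; minimal = minimal*
             ; large = subst (b ≤_) (sym ∣Y*∣≡∣Y∣) b≤∣Y∣ }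

  powers-of-two : Seed → 1 ≤ b → ∀ e → Witness (suc e) (2 ^ e + 1)
  powers-of-two s 1≤b zero =
    weaken (s≤s 1≤∣Y∣) (apex-step conn member minimal (∣p∣>0⇒nonempty blocker 1≤∣Y∣) large)
    where
    open Seed s
    1≤∣Y∣ : 1 ≤ ∣ blocker ∣
    1≤∣Y∣ = ≤-trans 1≤b large
  powers-of-two s 1≤b (suc e) =
    grow (powers-of-two s 1≤b e) (2 ^ suc e + 1) (≤-reflexive (double-power (2 ^ e)))

  -- b ≥ 2: the doubling extension of the seed (whose double is in C) gives d = 1
  scaled-powers : Seed → 2 ≤ b → ∀ e → Witness (suc e) ((b ∸ 1) * 2 ^ suc e + 1)
  scaled-powers s 2≤b zero =
    doubling-step conn (inClass (proj₁ robust graph graph member member)) minimal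
      (∣p∣>0⇒nonempty blocker (≤-trans 1≤b large))
      (≤-trans (≤-reflexive (+-comm 2 b)) (+-mono-≤ large (≤-trans 2≤b large)))
      ((b ∸ 1) * 2 + 1) (≤-trans (≤-reflexive (first-doubling b 1≤b)) (+-mono-≤ large large))
    where
    open Seed s
    1≤b : 1 ≤ b
    1≤b = ≤-trans (s≤s z≤n) 2≤b
  scaled-powers s 2≤b (suc e) =
    grow (scaled-powers s 2≤b e) ((b ∸ 1) * 2 ^ suc (suc e) + 1)
      (≤-reflexive (double-scaled (b ∸ 1) (2 ^ suc e)))

theorem21 : (C : Graph → Set) → GraphClass C → Robust C →
    (b : ℕ) → ClassBetaIs C b →
    (d : ℕ) → 1 ≤ d →
      (b ≡ 1 → BetaEdGe C d (2 ^ (d ∸ 1) + 1)) ×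
      (2 ≤ b → BetaEdGe C d ((b ∸ 1) * 2 ^ d + 1))
theorem21 C iso-closed robust b (β-bound , attained) (suc e) _ =
  (λ b≡1 → let 1≤b = ≤-reflexive (sym b≡1) in witness⇒β (powers-of-two (seed attained 1≤b) 1≤b e)) ,
  (λ 2≤b → witness⇒β (scaled-powers (seed attained (≤-trans (s≤s z≤n) 2≤b)) 2≤b e))
  where open Iteration C iso-closed robust b β-bound
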